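{- In the setting of the context, let $P\in{\cal F}$, let $D,D'$ be lines with $P\in D\cap D'$, and let $\hat g\in\mathrm{Aut}(\hat{\cal F}_\epsilon)$ with $\pi(\hat g)=g$. Then $\delta(\hat g,P,D)=\delta(\hat g,P,D')$.
   Context: $\mathbb F$ is a field of characteristic not $2$. ${\cal F}$ is a Fano plane with an automorphism $\tau$ of order $7$ such that with $P_i=\tau^i(P_0)$ ($i\in\mathbb Z_7$) the lines are exactly $D_i=\{P_i,P_{i+1},P_{i+3}\}$. $\epsilon$ is the canonical composition factor: $\epsilon_{P_iP_j}=1$ if $j-i\equiv1,2,4\pmod7$, $-1$ if $j-i\equiv3,5,6\pmod7$. $\mathbb O_{\cal F}$ has basis $1,e_P$, unit $1$, $e_Pe_Q=\epsilon_{PQ}e_{P+Q}$ ($P\ne Q$, $P+Q$ the third point on their line), $e_P^2=-1$. $L_x$ is left multiplication, $e_{P,Q}=\tfrac14(L_{e_P}L_{e_Q}-L_{e_Q}L_{e_P})$, and $X_{P_i,D_i}=e_{P_{i+2},P_{i-1}}-e_{P_{i-3},P_{i-2}}$, $X_{P_i,D_{i-1}}=e_{P_{i-3},P_{i-2}}-e_{P_{i+1},P_{i+3}}$, $X_{P_i,D_{i-3}}=e_{P_{i+1},P_{i+3}}-e_{P_{i+2},P_{i-1}}$. $\hat{\cal F}_\epsilon=\{\pm e_P\}$; $\mathrm{Aut}(\hat{\cal F}_\epsilon)$ is the group of maps $\hat h$ of $\hat{\cal F}_\epsilon$ with $\hat h(-e_P)=-\hat h(e_P)$ and $\hat h(e_Pe_Q)=\hat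 h(e_P)\hat h(e_Q)$ ($P\ne Q$); each $\hat h$ is extended to a linear automorphism of $\mathbb O_{\cal F}$ with $\hat h(1)=1$; $\pi(\hat h)$ is the induced permutation of ${\cal F}$. For an incident pair $(P,D)$ one has $\hat g X_{P,D}\hat g^{ -1}=\pm X_{g(P),g(D)}$ where $g=\pi(\hat g)$, and $\delta(\hat g,P,D)\in\{\pm1\}$ denotes this sign. -}

module Defs where

open import Level using (Level; suc; _⊔_)
open import Data.Nat as ℕ using (ℕ; _∸_)
open import Data.Nat.DivMod using (_mod_; _%_)
open import Data.Fin as Fin using (Fin; toℕ)
open import Data.Fin.Properties using () renaming (_≟_ to _≟F_)
open import Data.Sign as Sign using (Sign; opposite) renaming (+ to ⊕; - to ⊖)
open import Data.Product using (_×_; _,_; proj₁; proj₂)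
open import Data.Sum using (_⊎_)
open import Data.List using (List; _∷_; []; map; foldr)
open import Data.List using () renaming (allFin to allFinL)
open import Function using (_↔_; Inverse)
open import Relation.Nullary using (¬_; yes; no; Dec)
open import Relation.Binary.PropositionalEquality using (_≡_; _≢_; refl; cong)
open import Algebra.Bundles using (CommutativeRing)

record Field (c ℓ : Level) : Set (suc (c ⊔ ℓ)) where
  field
    commutativeRing : CommutativeRing c ℓ
  open CommutativeRing commutativeRing public
  field
    0≉1  : ¬ (0# ≈ 1#)
    _⁻¹  : (x : Carrier) → ¬ (x ≈ 0#) → Carrier
    ⁻¹-inverseʳ : (x : Carrier) (x≉0 : ¬ (x ≈ 0#)) → x * (x ⁻¹) x≉0 ≈ 1#

CharNot2 : ∀ {c ℓ} → Field c ℓ → Set ℓ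
CharNot2 𝔽 = ¬ (1# + 1# ≈ 0#) where open Field 𝔽

-- The Fano plane: P_i = i ∈ ℤ₇ (Fin 7), lines D_j = {P_j, P_{j+1}, P_{j+3}}
-- indexed by j ∈ ℤ₇.  τ is i ↦ i+1.

Point : Set
Point = Fin 7

Line : Set
Line = Fin 7

_⊹_ : Point → ℕ → Point
i ⊹ k = (toℕ i ℕ.+ k) mod 7

diff : Point → Point → ℕ
diff i j = (toℕ j ℕ.+ 7 ∸ toℕ i) % 7

_∈L_ : Point → Line → Set
P ∈L j = P ≡ j ⊎ (P ≡ j ⊹ 1 ⊎ P ≡ j ⊹ 3)

-- the canonical composition factor ε_{P_i P_j}
-- (value for P = Q is irrelevant and never used)
εD : ℕ → Sign
εD 1 = ⊕
εD 2 = ⊕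
εD 4 = ⊕
εD _ = ⊖

ε : Point → Point → Sign
ε P Q = εD (diff P Q)

-- third point P + Q on the line through P ≠ Q (value for P = Q irrelevant)
third : Point → Point → Point
third P Q = go (diff P Q)
  where
  go : ℕ → Point
  go 1 = P ⊹ 3
  go 6 = P ⊹ 2
  go 2 = P ⊹ 6
  go 5 = P ⊹ 4
  go 3 = P ⊹ 1
  go 4 = P ⊹ 5
  go _ = P

-- the line through P ≠ Q (value for P = Q irrelevant)
lineOf : Point → Point → Line
lineOf P Q = go (diff P Q)
  where
  go : ℕ → Line
  go 1 = P
  go 6 = Q
  go 2 = P ⊹ 6
  go 5 = Q ⊹ 6
  go 3 = P
  go 4 = Q
  go _ = P

data Basis : Set where
  one : Basis
  e   : Point → Basis

_≟B_ : (a b : Basis) → Dec (a ≡ b)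
one ≟B one = yes refl
one ≟B e _ = no (λ ())
e _ ≟B one = no (λ ())
e P ≟B e Q with P ≟F Q
... | yes refl = yes refl
... | no P≢Q = no (λ { refl → P≢Q refl })

allBasis : List Basis
allBasis = one ∷ map e (allFinL 7)

mulB : Basis → Basis → Sign × Basis
mulB one b = ⊕ , b
mulB (e P) one = ⊕ , e P
mulB (e P) (e Q) with P ≟F Q
... | yes _ = ⊖ , one
... | no _  = ε P Q , e (third P Q)

-- The signed set  F̂_ε = {± e_P}  and its automorphisms

SPt : Set
SPt = Sign × Point

pt : SPt → Point
pt = proj₂

neg : SPt → SPt
neg (s , P) = opposite s , P

mulS : SPt → SPt → SPt
mulS (s , P) (t , Q) = s Sign.* t Sign.* ε P Q , third P Q

record IsAut (h : SPt ↔ SPt) : Set where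
  open Inverse h
  field
    odd  : ∀ x → to (neg x) ≡ neg (to x)
    mult : ∀ x y → pt x ≢ pt y → to (mulS x y) ≡ mulS (to x) (to y)

π : (SPt ↔ SPt) → Point → Point
π h P = pt (Inverse.to h (⊕ , P))

πL : (SPt ↔ SPt) → Line → Line
πL h j = lineOf (π h j) (π h (j ⊹ 1))

module Oct {c ℓ} (𝔽 : Field c ℓ) where
  open Field 𝔽

  Vec8 : Set c
  Vec8 = Basis → Carrier

  End : Set c
  End = Vec8 → Vec8

  Σ : (Basis → Carrier) → Carrier
  Σ f = foldr (λ b acc → f b + acc) 0# allBasis

  _⊙_ : Sign → Carrier → Carrier
  ⊕ ⊙ x = x
  ⊖ ⊙ x = - x

  coord : Sign × Basis → Basis → Carrier
  coord (s , a) b with a ≟B b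
  ... | yes _ = s ⊙ 1#
  ... | no _  = 0#

  _·_ : Vec8 → Vec8 → Vec8
  (x · y) b = Σ λ a → Σ λ a' → (x a * y a') * coord (mulB a a') b

  basisVec : Basis → Vec8
  basisVec a = coord (⊕ , a)

  L : Vec8 → End
  L x y = x · y

  _∘E_ : End → End → End
  (A ∘E B) v = A (B v)

  _-E_ : End → End → End
  (A -E B) v b = A v b - B v b

  _*E_ : Carrier → End → End
  (k *E A) v b = k * A v b

  _⊙E_ : Sign → End → End
  (s ⊙E A) v b = s ⊙ A v b

  zeroE : End
  zeroE v b = 0#

  _≈E_ : End → End → Set (c ⊔ ℓ)
  A ≈E B = ∀ v b → A v b ≈ B v b

  module _ (char≠2 : CharNot2 𝔽) where
    half : Carrier
    half = ((1# + 1#) ⁻¹) char≠2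

    quarter : Carrier
    quarter = half * half

    eE : Point → Point → End
    eE P Q = quarter *E ((L (basisVec (e P)) ∘E L (basisVec (e Q)))
                        -E (L (basisVec (e Q)) ∘E L (basisVec (e P))))

    -- X_{P_i, D_j} for incident pairs (zero map for non-incident pairs;
    -- never used there)
    X : Point → Line → End
    X i j with j ≟F i | j ≟F (i ⊹ 6) | j ≟F (i ⊹ 4)
    ... | yes _ | _ | _ = eE (i ⊹ 2) (i ⊹ 6) -E eE (i ⊹ 4) (i ⊹ 5)
    ... | no _ | yes _ | _ = eE (i ⊹ 4) (i ⊹ 5) -E eE (i ⊹ 1) (i ⊹ 3)
    ... | no _ | no _ | yes _ = eE (i ⊹ 1) (i ⊹ 3) -E eE (i ⊹ 2) (i ⊹ 6)
    ... | no _ | no _ | no _ = zeroE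

  onBasis : (SPt → SPt) → Basis → Sign × Basis
  onBasis f one = ⊕ , one
  onBasis f (e P) with f (⊕ , P)
  ... | (s , Q) = s , e Q

  ext : (SPt → SPt) → End
  ext f v b = Σ λ a → v a * coord (onBasis f a) b

  IsDelta : CharNot2 𝔽 → (SPt ↔ SPt) → Point → Line → Sign → Set (c ⊔ ℓ)
  IsDelta ch h P D s =
    (ext (Inverse.to h) ∘E (X ch P D ∘E ext (Inverse.from h)))
      ≈E (s ⊙E X ch (π h P) (πL h D))

-- Both X_{P,D} and X_{P,D′} are 1/4 times integer matrices, and ĝ acts on 𝕆 by a signed
-- permutation matrix, so conjugating and taking traces gives
--   tr (X_{P,D} X_{P,D′}) = δ(ĝ,P,D) δ(ĝ,P,D′) tr (X_{g P,g D} X_{g P,g D′}).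
-- A finite computation shows that 16 tr (X_{Q,E} X_{Q,E′}) is −64 or 32 for lines E, E′
-- through Q, and is one of −64, 32, 0 for arbitrary lines.  If the two signs differed, the
-- two traces would add up to 0; but every such sum is ±2^k, which does not vanish in
-- characteristic ≠ 2.
module Submission where

open import Defs
open import Level using (Level; _⊔_)
open import Data.Sign using (Sign)
open import Function using (_↔_)
open import Relation.Binary.PropositionalEquality using (_≡_)
open import Relation.Binary.PropositionalEquality as ≡ using (refl)

open import Data.Bool using (if_then_else_)
open import Data.Fin.Properties using (all?) renaming (_≟_ to _≟F_)
open import Data.List using (List; []; _∷_; foldr; filter; length)
open import Data.Nat as ℕ using (ℕ; zero; suc; _∸_; _^_)
open import Data.Nat.Properties using () renaming (_≟_ to _≟ℕ_)
open import Data.Product using (_×_; _,_; proj₁; proj₂)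
open import Data.Product.Properties using (≡-dec)
open import Data.Sign as Sign using () renaming (+ to ⊕; - to ⊖)
open import Data.Sign.Properties using (s*s≡+)
open import Data.Empty using (⊥-elim)
open import Data.List.Relation.Unary.Any using (here; there)
open import Function using (Inverse)
open import Relation.Nullary using (Dec; yes; no; does)
open import Relation.Nullary.Decidable using (from-yes; _⊎-dec_; _→-dec_)
open import Relation.Binary.Bundles using (Setoid)
import Relation.Binary.Reasoning.Setoid

-- (p , n) stands for the integer p − n.
Diff : Set
Diff = ℕ × ℕ

infixl 6 _+ᵈ_ _-ᵈ_
infixl 7 _*ᵈ_

_+ᵈ_ _*ᵈ_ : Diff → Diff → Diff
(a , b) +ᵈ (c , d) = a ℕ.+ c , b ℕ.+ d
(a , b) *ᵈ (c , d) = a ℕ.* c ℕ.+ b ℕ.* d , a ℕ.* d ℕ.+ b ℕ.* c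

-ᵈ_ : Diff → Diff
-ᵈ (a , b) = b , a

_-ᵈ_ : Diff → Diff → Diff
x -ᵈ y = x +ᵈ -ᵈ y

0ᵈ : Diff
0ᵈ = 0 , 0

signᵈ : Sign → Diff
signᵈ ⊕ = 1 , 0
signᵈ ⊖ = 0 , 1

canonical : Diff → Diff
canonical (p , n) = p ∸ n , n ∸ p

_≟ᵈ_ : (x y : Diff) → Dec (x ≡ y)
_≟ᵈ_ = ≡-dec _≟ℕ_ _≟ℕ_

open import Data.List.Membership.DecPropositional _≟ᵈ_ using (_∈_; _∈?_)

ΣLᵈ : {A : Set} → List A → (A → Diff) → Diff
ΣLᵈ xs f = foldr (λ a acc → f a +ᵈ acc) 0ᵈ xs

Σᵈ : (Basis → Diff) → Diff
Σᵈ = ΣLᵈ allBasis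

Matᵈ : Set
Matᵈ = Basis → Basis → Diff

infixl 7 _⋆ᵈ_
infixl 6 _⊟ᵈ_

_⋆ᵈ_ _⊟ᵈ_ : Matᵈ → Matᵈ → Matᵈ
(m ⋆ᵈ n) a b = Σᵈ λ k → m a k *ᵈ n k b
(m ⊟ᵈ n) a b = m a b -ᵈ n a b

0ᵈᴹ : Matᵈ
0ᵈᴹ a b = 0ᵈ

trᵈ : Matᵈ → Diff
trᵈ m = Σᵈ λ a → m a a

SBasis : Set
SBasis = Sign × Basis

_·ˢ_ : Sign → SBasis → SBasis
s ·ˢ (t , a) = s Sign.* t , a

_∘ˢ_ : (Basis → SBasis) → (Basis → SBasis) → Basis → SBasis
(φ ∘ˢ ψ) a = proj₁ (ψ a) ·ˢ φ (proj₂ (ψ a))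

coordᵈ : SBasis → Basis → Diff
coordᵈ (s , a) b = if does (a ≟B b) then signᵈ s else 0ᵈ

monomialᵈ : (Basis → SBasis) → Matᵈ
monomialᵈ φ a b = coordᵈ (φ b) a

left : Point → Basis → SBasis
left p = mulB (e p)

-- commᵈ P Q = 4 e_{P,Q} and Xᵈ P D = 4 X_{P,D}; Xᵈ repeats the case split of X clause by clause,
-- so that a single `with` reduces both.
commᵈ : Point → Point → Matᵈ
commᵈ P Q = monomialᵈ (left P ∘ˢ left Q) ⊟ᵈ monomialᵈ (left Q ∘ˢ left P)

Xᵈ : Point → Line → Matᵈ
Xᵈ i j with j ≟F i | j ≟F (i ⊹ 6) | j ≟F (i ⊹ 4)
... | yes _ | _     | _     = commᵈ (i ⊹ 2) (i ⊹ 6) ⊟ᵈ commᵈ (i ⊹ 4) (i ⊹ 5)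
... | no _  | yes _ | _     = commᵈ (i ⊹ 4) (i ⊹ 5) ⊟ᵈ commᵈ (i ⊹ 1) (i ⊹ 3)
... | no _  | no _  | yes _ = commᵈ (i ⊹ 1) (i ⊹ 3) ⊟ᵈ commᵈ (i ⊹ 2) (i ⊹ 6)
... | no _  | no _  | no _  = 0ᵈᴹ

_∈L?_ : ∀ P D → Dec (P ∈L D)
P ∈L? D = P ≟F D ⊎-dec P ≟F D ⊹ 1 ⊎-dec P ≟F D ⊹ 3

incidentTraces traceValues : List Diff
incidentTraces = (0 , 64) ∷ (32 , 0) ∷ []
traceValues = 0ᵈ ∷ incidentTraces

trᵈ-Xᵈ : ∀ P D D′ → canonical (trᵈ (Xᵈ P D ⋆ᵈ Xᵈ P D′)) ∈ traceValues
trᵈ-Xᵈ = from-yes (all? λ P → all? λ D → all? λ D′ →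
  canonical (trᵈ (Xᵈ P D ⋆ᵈ Xᵈ P D′)) ∈? traceValues)

trᵈ-Xᵈ-incident : ∀ P D D′ → P ∈L D → P ∈L D′ →
                  canonical (trᵈ (Xᵈ P D ⋆ᵈ Xᵈ P D′)) ∈ incidentTraces
trᵈ-Xᵈ-incident = from-yes (all? λ P → all? λ D → all? λ D′ →
  P ∈L? D →-dec P ∈L? D′ →-dec canonical (trᵈ (Xᵈ P D ⋆ᵈ Xᵈ P D′)) ∈? incidentTraces)

module LinearAlgebra {c ℓ} (𝔽 : Field c ℓ) where
  open Field 𝔽 hiding (zero)
    renaming (refl to ≈-refl; sym to ≈-sym; trans to ≈-trans; reflexive to ≈-reflexive)
  open Oct 𝔽
  open import Algebra.Properties.Ring ring using (-‿distribʳ-*; -1*x≈-x; x[y-z]≈xy-xz; [y-z]x≈yx-zx)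
  open import Algebra.Properties.AbelianGroup +-abelianGroup using (⁻¹-anti-homo‿-; ⁻¹-∙-comm)
  open import Algebra.Properties.Group +-group using (⁻¹-involutive; ε⁻¹≈ε)
  open import Algebra.Properties.CommutativeSemigroup +-commutativeSemigroup using (interchange)
  open import Algebra.Properties.CommutativeSemigroup *-commutativeSemigroup
    using () renaming (interchange to *-interchange)
  open import Algebra.Properties.Semiring.Mult semiring
    using (×-homo-1; ×-homo-+; ×1-homo-*) renaming (_×_ to _×ₙ_)
  module ≈-Reasoning = Relation.Binary.Reasoning.Setoid setoid

  ΣL : {A : Set} → List A → (A → Carrier) → Carrier
  ΣL xs f = foldr (λ a acc → f a + acc) 0# xs

  ΣL-cong : ∀ {A : Set} (xs : List A) {f g} → (∀ a → f a ≈ g a) → ΣL xs f ≈ ΣL xs g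
  ΣL-cong []       f≈g = ≈-refl
  ΣL-cong (x ∷ xs) f≈g = +-cong (f≈g x) (ΣL-cong xs f≈g)

  ΣL-0 : ∀ {A : Set} (xs : List A) → ΣL xs (λ _ → 0#) ≈ 0#
  ΣL-0 []       = ≈-refl
  ΣL-0 (x ∷ xs) = ≈-trans (+-identityˡ _) (ΣL-0 xs)

  ΣL-+ : ∀ {A : Set} (xs : List A) f g → ΣL xs (λ a → f a + g a) ≈ ΣL xs f + ΣL xs g
  ΣL-+ []       f g = ≈-sym (+-identityʳ 0#)
  ΣL-+ (x ∷ xs) f g = ≈-trans (+-congˡ (ΣL-+ xs f g)) (interchange (f x) (g x) _ _)

  ΣL-*ˡ : ∀ {A : Set} (xs : List A) k f → ΣL xs (λ a → k * f a) ≈ k * ΣL xs f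
  ΣL-*ˡ []       k f = ≈-sym (zeroʳ k)
  ΣL-*ˡ (x ∷ xs) k f = ≈-trans (+-congˡ (ΣL-*ˡ xs k f)) (≈-sym (distribˡ k (f x) _))

  ΣL-neg : ∀ {A : Set} (xs : List A) f → ΣL xs (λ a → - f a) ≈ - ΣL xs f
  ΣL-neg []       f = ≈-sym ε⁻¹≈ε
  ΣL-neg (x ∷ xs) f = ≈-trans (+-congˡ (ΣL-neg xs f)) (⁻¹-∙-comm (f x) _)

  ΣL-swap : ∀ {A B : Set} (xs : List A) (ys : List B) (f : A → B → Carrier) →
            ΣL xs (λ a → ΣL ys (f a)) ≈ ΣL ys (λ b → ΣL xs (λ a → f a b))
  ΣL-swap []       ys f = ≈-sym (ΣL-0 ys)
  ΣL-swap (x ∷ xs) ys f =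
    ≈-trans (+-congˡ (ΣL-swap xs ys f)) (≈-sym (ΣL-+ ys (f x) _))

  ΣL-pick : ∀ xs c (g : Basis → Carrier) →
            ΣL xs (λ k → g k * coord (⊕ , c) k) ≈ length (filter (c ≟B_) xs) ×ₙ g c
  ΣL-pick []       c g = ≈-refl
  ΣL-pick (k ∷ xs) c g with c ≟B k
  ... | yes refl = +-cong (*-identityʳ (g c)) (ΣL-pick xs c g)
  ... | no _     = ≈-trans (+-congʳ (zeroʳ (g k))) (≈-trans (+-identityˡ _) (ΣL-pick xs c g))

  basis-occurs-once : ∀ c → length (filter (c ≟B_) allBasis) ≡ 1
  basis-occurs-once one   = refl
  basis-occurs-once (e P) =
    from-yes (all? λ P → length (filter (e P ≟B_) allBasis) ≟ℕ 1) P

  Σ-cong : ∀ {f g} → (∀ a → f a ≈ g a) → Σ f ≈ Σ g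
  Σ-cong = ΣL-cong allBasis

  Σ-*ʳ : ∀ k f → Σ (λ a → f a * k) ≈ Σ f * k
  Σ-*ʳ k f = ≈-trans (Σ-cong {λ a → f a * k} {λ a → k * f a} λ a → *-comm (f a) k)
                     (≈-trans (ΣL-*ˡ allBasis k f) (*-comm k (Σ f)))

  Σ-pick : ∀ c g → Σ (λ k → g k * coord (⊕ , c) k) ≈ g c
  Σ-pick c g = begin
    Σ (λ k → g k * coord (⊕ , c) k)             ≈⟨ ΣL-pick allBasis c g ⟩
    length (filter (c ≟B_) allBasis) ×ₙ g c     ≡⟨ ≡.cong (_×ₙ g c) (basis-occurs-once c) ⟩
    1 ×ₙ g c                                     ≈⟨ ×-homo-1 (g c) ⟩
    g c                                          ∎
    where open ≈-Reasoning

  ⊙-≈-* : ∀ s x → s ⊙ x ≈ (s ⊙ 1#) * x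
  ⊙-≈-* ⊕ x = ≈-sym (*-identityˡ x)
  ⊙-≈-* ⊖ x = ≈-sym (-1*x≈-x x)

  ⊙-cong : ∀ s {x y} → x ≈ y → s ⊙ x ≈ s ⊙ y
  ⊙-cong ⊕ x≈y = x≈y
  ⊙-cong ⊖ x≈y = -‿cong x≈y

  ⊙-*ʳ : ∀ s x y → x * (s ⊙ y) ≈ s ⊙ (x * y)
  ⊙-*ʳ ⊕ x y = ≈-refl
  ⊙-*ʳ ⊖ x y = ≈-sym (-‿distribʳ-* x y)

  Σ-⊙ : ∀ s f → Σ (λ a → s ⊙ f a) ≈ s ⊙ Σ f
  Σ-⊙ ⊕ f = ≈-refl
  Σ-⊙ ⊖ f = ΣL-neg allBasis f

  ⊙-0# : ∀ s → s ⊙ 0# ≈ 0#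
  ⊙-0# ⊕ = ≈-refl
  ⊙-0# ⊖ = ε⁻¹≈ε

  ⊙-⊙ : ∀ s t x → s ⊙ (t ⊙ x) ≈ (s Sign.* t) ⊙ x
  ⊙-⊙ ⊕ t x = ≈-refl
  ⊙-⊙ ⊖ ⊕ x = ≈-refl
  ⊙-⊙ ⊖ ⊖ x = ⁻¹-involutive x

  coord-sign : ∀ s a b → coord (s , a) b ≈ s ⊙ coord (⊕ , a) b
  coord-sign s a b with a ≟B b
  ... | yes _ = ≈-refl
  ... | no _  = ≈-sym (⊙-0# s)

  coord-·ˢ : ∀ s x b → coord (s ·ˢ x) b ≈ s ⊙ coord x b
  coord-·ˢ s (t , a) b with a ≟B b
  ... | yes _ = ≈-sym (⊙-⊙ s t 1#)
  ... | no _  = ≈-sym (⊙-0# s)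

  Mat : Set c
  Mat = Basis → Basis → Carrier

  infix 4 _≋_
  _≋_ : Mat → Mat → Set ℓ
  m ≋ n = ∀ a b → m a b ≈ n a b

  ≋-setoid : Setoid c ℓ
  ≋-setoid = record
    { Carrier       = Mat
    ; _≈_           = _≋_
    ; isEquivalence = record
      { refl  = λ _ _ → ≈-refl
      ; sym   = λ m≋n a b → ≈-sym (m≋n a b)
      ; trans = λ m≋n n≋p a b → ≈-trans (m≋n a b) (n≋p a b)
      }
    }

  module ≋-Reasoning = Relation.Binary.Reasoning.Setoid ≋-setoid

  infixl 7 _∙ᴹ_
  infixl 6 _⊟_

  _⊟_ : Mat → Mat → Mat
  (m ⊟ n) a b = m a b - n a b

  _∙ᴹ_ : Carrier → Mat → Mat
  (k ∙ᴹ m) a b = k * m a b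

  monomial : (Basis → SBasis) → Mat
  monomial φ a b = coord (φ b) a

  1ᴹ : Mat
  1ᴹ = monomial (⊕ ,_)

  apply : Mat → End
  apply m v a = Σ λ b → m a b * v b

  apply-cong : ∀ m {v w} → (∀ b → v b ≈ w b) → ∀ a → apply m v a ≈ apply m w a
  apply-cong m {v} {w} v≈w a =
    Σ-cong {λ b → m a b * v b} {λ b → m a b * w b} λ b → *-congˡ (v≈w b)

  apply-basisVec : ∀ m b a → apply m (basisVec b) a ≈ m a b
  apply-basisVec m b a = Σ-pick b (m a)

  -- Kept opaque so that unification never unfolds a product into its eight-term sum.
  opaque
    infixl 7 _⋆_

    _⋆_ : Mat → Mat → Mat
    (m ⋆ n) a b = Σ λ k → m a k * n k b

    tr : Mat → Carrier
    tr m = Σ λ a → m a a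

    apply-⋆ : ∀ m n v a → apply (m ⋆ n) v a ≈ apply m (apply n v) a
    apply-⋆ m n v a = begin
      Σ (λ b → Σ (λ k → m a k * n k b) * v b)
        ≈⟨ Σ-cong (λ b → ≈-sym (Σ-*ʳ (v b) λ k → m a k * n k b)) ⟩
      Σ (λ b → Σ (λ k → (m a k * n k b) * v b))
        ≈⟨ Σ-cong (λ b → Σ-cong λ k → *-assoc (m a k) (n k b) (v b)) ⟩
      Σ (λ b → Σ (λ k → m a k * (n k b * v b)))
        ≈⟨ ΣL-swap allBasis allBasis (λ b k → m a k * (n k b * v b)) ⟩
      Σ (λ k → Σ (λ b → m a k * (n k b * v b)))
        ≈⟨ Σ-cong (λ k → ΣL-*ˡ allBasis (m a k) λ b → n k b * v b) ⟩
      Σ (λ k → m a k * apply n v k) ∎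
      where open ≈-Reasoning

    ⋆-assoc : ∀ m n p → (m ⋆ n) ⋆ p ≋ m ⋆ (n ⋆ p)
    ⋆-assoc m n p a b = apply-⋆ m n (λ k → p k b) a

    ⋆-cong : ∀ {m m′ n n′} → m ≋ m′ → n ≋ n′ → m ⋆ n ≋ m′ ⋆ n′
    ⋆-cong {m} {m′} {n} {n′} m≋m′ n≋n′ a b =
      Σ-cong {λ k → m a k * n k b} {λ k → m′ a k * n′ k b} λ k → *-cong (m≋m′ a k) (n≋n′ k b)

    ⋆-identityʳ : ∀ m → m ⋆ 1ᴹ ≋ m
    ⋆-identityʳ m a b = apply-basisVec m b a

    tr-cong : ∀ {m n} → m ≋ n → tr m ≈ tr n
    tr-cong {m} {n} m≋n = Σ-cong {λ a → m a a} {λ a → n a a} λ a → m≋n a a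

    tr-comm : ∀ m n → tr (m ⋆ n) ≈ tr (n ⋆ m)
    tr-comm m n = ≈-trans (ΣL-swap allBasis allBasis λ a k → m a k * n k a)
      (Σ-cong {λ k → Σ λ a → m a k * n k a} {λ k → Σ λ a → n k a * m a k} λ k →
         Σ-cong {λ a → m a k * n k a} {λ a → n k a * m a k} λ a → *-comm (m a k) (n k a))

    tr-∙ᴹ : ∀ k k′ m n → tr ((k ∙ᴹ m) ⋆ (k′ ∙ᴹ n)) ≈ (k * k′) * tr (m ⋆ n)
    tr-∙ᴹ k k′ m n = begin
      Σ (λ a → Σ λ b → (k * m a b) * (k′ * n b a))
        ≈⟨ Σ-cong (λ a → Σ-cong λ b → *-interchange k (m a b) k′ (n b a)) ⟩
      Σ (λ a → Σ λ b → (k * k′) * (m a b * n b a))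
        ≈⟨ Σ-cong (λ a → ΣL-*ˡ allBasis (k * k′) λ b → m a b * n b a) ⟩
      Σ (λ a → (k * k′) * Σ (λ b → m a b * n b a))
        ≈⟨ ΣL-*ˡ allBasis (k * k′) (λ a → Σ λ b → m a b * n b a) ⟩
      (k * k′) * Σ (λ a → Σ λ b → m a b * n b a) ∎
      where open ≈-Reasoning

  ⋆-congˡ : ∀ m {n n′} → n ≋ n′ → m ⋆ n ≋ m ⋆ n′
  ⋆-congˡ m = ⋆-cong {m} (λ _ _ → ≈-refl)

  ⋆-congʳ : ∀ {m m′ n} → m ≋ m′ → m ⋆ n ≋ m′ ⋆ n
  ⋆-congʳ {n = n} m≋m′ = ⋆-cong {n = n} m≋m′ (λ _ _ → ≈-refl)

  ⋆-conj : ∀ {m n} p p′ → n ⋆ m ≋ 1ᴹ →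
           (m ⋆ (p ⋆ n)) ⋆ (m ⋆ (p′ ⋆ n)) ≋ m ⋆ ((p ⋆ p′) ⋆ n)
  ⋆-conj {m} {n} p p′ n⋆m≋1 = begin
    (m ⋆ (p ⋆ n)) ⋆ (m ⋆ (p′ ⋆ n))   ≈⟨ ⋆-assoc m (p ⋆ n) (m ⋆ (p′ ⋆ n)) ⟩
    m ⋆ ((p ⋆ n) ⋆ (m ⋆ (p′ ⋆ n)))   ≈⟨ ⋆-congˡ m (⋆-assoc (p ⋆ n) m (p′ ⋆ n)) ⟨
    m ⋆ (((p ⋆ n) ⋆ m) ⋆ (p′ ⋆ n))   ≈⟨ ⋆-congˡ m (⋆-congʳ (⋆-assoc p n m)) ⟩
    m ⋆ ((p ⋆ (n ⋆ m)) ⋆ (p′ ⋆ n))   ≈⟨ ⋆-congˡ m (⋆-congʳ (⋆-congˡ p n⋆m≋1)) ⟩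
    m ⋆ ((p ⋆ 1ᴹ) ⋆ (p′ ⋆ n))        ≈⟨ ⋆-congˡ m (⋆-congʳ (⋆-identityʳ p)) ⟩
    m ⋆ (p ⋆ (p′ ⋆ n))               ≈⟨ ⋆-congˡ m (⋆-assoc p p′ n) ⟨
    m ⋆ ((p ⋆ p′) ⋆ n)               ∎
    where open ≋-Reasoning

  tr-conj : ∀ {m n} p p′ → n ⋆ m ≋ 1ᴹ →
            tr ((m ⋆ (p ⋆ n)) ⋆ (m ⋆ (p′ ⋆ n))) ≈ tr (p ⋆ p′)
  tr-conj {m} {n} p p′ n⋆m≋1 = begin
    tr ((m ⋆ (p ⋆ n)) ⋆ (m ⋆ (p′ ⋆ n)))   ≈⟨ tr-cong (⋆-conj p p′ n⋆m≋1) ⟩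
    tr (m ⋆ ((p ⋆ p′) ⋆ n))              ≈⟨ tr-comm m ((p ⋆ p′) ⋆ n) ⟩
    tr (((p ⋆ p′) ⋆ n) ⋆ m)              ≈⟨ tr-cong (⋆-assoc (p ⋆ p′) n m) ⟩
    tr ((p ⋆ p′) ⋆ (n ⋆ m))              ≈⟨ tr-cong (⋆-congˡ (p ⋆ p′) n⋆m≋1) ⟩
    tr ((p ⋆ p′) ⋆ 1ᴹ)                   ≈⟨ tr-cong (⋆-identityʳ (p ⋆ p′)) ⟩
    tr (p ⋆ p′)                          ∎
    where open ≈-Reasoning

  record Represents (f : End) (m : Mat) : Set (c ⊔ ℓ) where
    constructor represents
    field ≈-apply : ∀ v a → f v a ≈ apply m v a

  Represents-cong : ∀ {f m n} → Represents f m → m ≋ n → Represents f n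
  Represents-cong {m = m} {n} (represents f∼m) m≋n = represents λ v a →
    ≈-trans (f∼m v a) (Σ-cong {λ b → m a b * v b} {λ b → n a b * v b} λ b → *-congʳ (m≋n a b))

  Represents-∘E : ∀ {f g m n} → Represents f m → Represents g n → Represents (f ∘E g) (m ⋆ n)
  Represents-∘E {f} {g} {m} {n} (represents f∼m) (represents g∼n) = represents λ v a → begin
    f (g v) a               ≈⟨ f∼m (g v) a ⟩
    apply m (g v) a         ≈⟨ apply-cong m (g∼n v) a ⟩
    apply m (apply n v) a   ≈⟨ apply-⋆ m n v a ⟨
    apply (m ⋆ n) v a       ∎
    where open ≈-Reasoning

  Represents--E : ∀ {f g m n} → Represents f m → Represents g n → Represents (f -E g) (m ⊟ n)
  Represents--E {f} {g} {m} {n} (represents f∼m) (represents g∼n) = represents λ v a → begin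
    f v a - g v a
      ≈⟨ +-cong (f∼m v a) (-‿cong (g∼n v a)) ⟩
    apply m v a - apply n v a
      ≈⟨ +-congˡ (ΣL-neg allBasis λ b → n a b * v b) ⟨
    apply m v a + Σ (λ b → - (n a b * v b))
      ≈⟨ ΣL-+ allBasis (λ b → m a b * v b) (λ b → - (n a b * v b)) ⟨
    Σ (λ b → m a b * v b + - (n a b * v b))
      ≈⟨ Σ-cong (λ b → [y-z]x≈yx-zx (v b) (m a b) (n a b)) ⟨
    apply (m ⊟ n) v a ∎
    where open ≈-Reasoning

  Represents-*E : ∀ {f m} k → Represents f m → Represents (k *E f) (k ∙ᴹ m)
  Represents-*E {f} {m} k (represents f∼m) = represents λ v a → begin
    k * f v a                           ≈⟨ *-congˡ (f∼m v a) ⟩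
    k * apply m v a                     ≈⟨ ΣL-*ˡ allBasis k (λ b → m a b * v b) ⟨
    Σ (λ b → k * (m a b * v b))         ≈⟨ Σ-cong (λ b → *-assoc k (m a b) (v b)) ⟨
    apply (k ∙ᴹ m) v a                  ∎
    where open ≈-Reasoning

  Represents-⊙E : ∀ {f m} s → Represents f m → Represents (s ⊙E f) ((s ⊙ 1#) ∙ᴹ m)
  Represents-⊙E {f} s f∼m = represents λ v a →
    ≈-trans (⊙-≈-* s (f v a)) (Represents.≈-apply (Represents-*E (s ⊙ 1#) f∼m) v a)

  Represents-zeroE : ∀ {m} → (∀ a b → m a b ≈ 0#) → Represents zeroE m
  Represents-zeroE {m} m≈0 = represents λ v a → ≈-sym (≈-trans
    (Σ-cong {λ b → m a b * v b} {λ _ → 0#} λ b → ≈-trans (*-congʳ (m≈0 a b)) (zeroˡ (v b)))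
    (ΣL-0 allBasis))

  ≈E⇒≋ : ∀ {f g m n} → Represents f m → Represents g n → f ≈E g → m ≋ n
  ≈E⇒≋ {f} {g} {m} {n} (represents f∼m) (represents g∼n) f≈g a b = begin
    m a b                          ≈⟨ apply-basisVec m b a ⟨
    apply m (basisVec b) a         ≈⟨ f∼m (basisVec b) a ⟨
    f (basisVec b) a               ≈⟨ f≈g (basisVec b) a ⟩
    g (basisVec b) a               ≈⟨ g∼n (basisVec b) a ⟩
    apply n (basisVec b) a         ≈⟨ apply-basisVec n b a ⟩
    n a b                          ∎
    where open ≈-Reasoning

  opaque
    unfolding _⋆_

    monomial-⋆ : ∀ φ ψ → monomial φ ⋆ monomial ψ ≋ monomial (φ ∘ˢ ψ)
    monomial-⋆ φ ψ a b = begin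
      Σ (λ k → coord (φ k) a * coord (s , d) k)
        ≈⟨ Σ-cong (λ k → *-congˡ {coord (φ k) a} (coord-sign s d k)) ⟩
      Σ (λ k → coord (φ k) a * (s ⊙ coord (⊕ , d) k))
        ≈⟨ Σ-cong (λ k → ⊙-*ʳ s (coord (φ k) a) (coord (⊕ , d) k)) ⟩
      Σ (λ k → s ⊙ (coord (φ k) a * coord (⊕ , d) k))
        ≈⟨ Σ-⊙ s (λ k → coord (φ k) a * coord (⊕ , d) k) ⟩
      s ⊙ Σ (λ k → coord (φ k) a * coord (⊕ , d) k)
        ≈⟨ ⊙-cong s (Σ-pick d λ k → coord (φ k) a) ⟩
      s ⊙ coord (φ d) a
        ≈⟨ coord-·ˢ s (φ d) a ⟨
      coord (s ·ˢ φ d) a ∎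
      where
      open ≈-Reasoning
      s : Sign
      s = proj₁ (ψ b)
      d : Basis
      d = proj₂ (ψ b)

  L-basisVec : ∀ p v b → L (basisVec (e p)) v b ≈ apply (monomial (left p)) v b
  L-basisVec p v b = begin
    Σ (λ a → Σ λ a′ → (x a * v a′) * C a a′)
      ≈⟨ Σ-cong (λ a → Σ-cong λ a′ → rearrange (x a) (v a′) (C a a′)) ⟩
    Σ (λ a → Σ λ a′ → (C a a′ * v a′) * x a)
      ≈⟨ Σ-cong (λ a → Σ-*ʳ (x a) λ a′ → C a a′ * v a′) ⟩
    Σ (λ a → Σ (λ a′ → C a a′ * v a′) * x a)
      ≈⟨ Σ-pick (e p) (λ a → Σ λ a′ → C a a′ * v a′) ⟩
    Σ (λ a′ → C (e p) a′ * v a′) ∎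
    where
    open ≈-Reasoning
    x : Vec8
    x = basisVec (e p)
    C : Basis → Basis → Carrier
    C a a′ = coord (mulB a a′) b
    rearrange : ∀ x y z → (x * y) * z ≈ (z * y) * x
    rearrange x y z =
      ≈-trans (*-comm (x * y) z) (≈-trans (*-congˡ (*-comm x y)) (≈-sym (*-assoc z y x)))

  Represents-L : ∀ p → Represents (L (basisVec (e p))) (monomial (left p))
  Represents-L p = represents (L-basisVec p)

  Represents-ext : ∀ f → Represents (ext f) (monomial (onBasis f))
  Represents-ext f = represents λ v b →
    Σ-cong {λ a → v a * coord (onBasis f a) b} {λ a → coord (onBasis f a) b * v a} λ a →
      *-comm (v a) (coord (onBasis f a) b)

  ⟦_⟧ℕ : ℕ → Carrier
  ⟦ n ⟧ℕ = n ×ₙ 1#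

  ⟦_⟧ : Diff → Carrier
  ⟦ (p , n) ⟧ = ⟦ p ⟧ℕ - ⟦ n ⟧ℕ

  ⟦_⟧ᴹ : Matᵈ → Mat
  ⟦ m ⟧ᴹ a b = ⟦ m a b ⟧

  x-0#≈x : ∀ x → x - 0# ≈ x
  x-0#≈x x = ≈-trans (+-congˡ ε⁻¹≈ε) (+-identityʳ x)

  ⟦0ᵈ⟧ : ⟦ 0ᵈ ⟧ ≈ 0#
  ⟦0ᵈ⟧ = -‿inverseʳ 0#

  ⟦+ᵈ⟧ : ∀ x y → ⟦ x +ᵈ y ⟧ ≈ ⟦ x ⟧ + ⟦ y ⟧
  ⟦+ᵈ⟧ (a , b) (c , d) = begin
    ⟦ a ℕ.+ c ⟧ℕ - ⟦ b ℕ.+ d ⟧ℕ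
      ≈⟨ +-cong (×-homo-+ 1# a c) (-‿cong (×-homo-+ 1# b d)) ⟩
    (⟦ a ⟧ℕ + ⟦ c ⟧ℕ) - (⟦ b ⟧ℕ + ⟦ d ⟧ℕ)
      ≈⟨ +-congˡ (⁻¹-∙-comm ⟦ b ⟧ℕ ⟦ d ⟧ℕ) ⟨
    (⟦ a ⟧ℕ + ⟦ c ⟧ℕ) + (- ⟦ b ⟧ℕ + - ⟦ d ⟧ℕ)
      ≈⟨ interchange ⟦ a ⟧ℕ ⟦ c ⟧ℕ (- ⟦ b ⟧ℕ) (- ⟦ d ⟧ℕ) ⟩
    (⟦ a ⟧ℕ - ⟦ b ⟧ℕ) + (⟦ c ⟧ℕ - ⟦ d ⟧ℕ) ∎
    where open ≈-Reasoning

  ⟦-ᵈ⟧ : ∀ x → ⟦ -ᵈ x ⟧ ≈ - ⟦ x ⟧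
  ⟦-ᵈ⟧ (a , b) = ≈-sym (⁻¹-anti-homo‿- ⟦ a ⟧ℕ ⟦ b ⟧ℕ)

  ⟦*ᵈ⟧ : ∀ x y → ⟦ x *ᵈ y ⟧ ≈ ⟦ x ⟧ * ⟦ y ⟧
  ⟦*ᵈ⟧ (a , b) (c , d) = begin
    ⟦ a ℕ.* c ℕ.+ b ℕ.* d ⟧ℕ - ⟦ a ℕ.* d ℕ.+ b ℕ.* c ⟧ℕ
      ≈⟨ +-cong (homo a c b d) (-‿cong (homo a d b c)) ⟩
    (A * C + B * D) - (A * D + B * C)
      ≈⟨ regroup (A * C) (B * C) (A * D) (B * D) ⟨
    (A * C - B * C) - (A * D - B * D)
      ≈⟨ +-cong ([y-z]x≈yx-zx C A B) (-‿cong ([y-z]x≈yx-zx D A B)) ⟨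
    (A - B) * C - (A - B) * D
      ≈⟨ x[y-z]≈xy-xz (A - B) C D ⟨
    (A - B) * (C - D) ∎
    where
    open ≈-Reasoning
    A B C D : Carrier
    A = ⟦ a ⟧ℕ
    B = ⟦ b ⟧ℕ
    C = ⟦ c ⟧ℕ
    D = ⟦ d ⟧ℕ
    homo : ∀ m n m′ n′ → ⟦ m ℕ.* n ℕ.+ m′ ℕ.* n′ ⟧ℕ ≈ ⟦ m ⟧ℕ * ⟦ n ⟧ℕ + ⟦ m′ ⟧ℕ * ⟦ n′ ⟧ℕ
    homo m n m′ n′ =
      ≈-trans (×-homo-+ 1# (m ℕ.* n) (m′ ℕ.* n′)) (+-cong (×1-homo-* m n) (×1-homo-* m′ n′))
    regroup : ∀ p q r s → (p - q) - (r - s) ≈ (p + s) - (r + q)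
    regroup p q r s = begin
      (p - q) - (r - s)       ≈⟨ +-congˡ (⁻¹-anti-homo‿- r s) ⟩
      (p - q) + (s - r)       ≈⟨ interchange p (- q) s (- r) ⟩
      (p + s) + (- q - r)     ≈⟨ +-congˡ (⁻¹-∙-comm q r) ⟩
      (p + s) - (q + r)       ≈⟨ +-congˡ (-‿cong (+-comm q r)) ⟩
      (p + s) - (r + q)       ∎

  ⟦signᵈ⟧ : ∀ s → ⟦ signᵈ s ⟧ ≈ s ⊙ 1#
  ⟦signᵈ⟧ ⊕ = ≈-trans (x-0#≈x ⟦ 1 ⟧ℕ) (×-homo-1 1#)
  ⟦signᵈ⟧ ⊖ = ≈-trans (+-identityˡ (- ⟦ 1 ⟧ℕ)) (-‿cong (×-homo-1 1#))

  ⟦coordᵈ⟧ : ∀ x b → ⟦ coordᵈ x b ⟧ ≈ coord x b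
  ⟦coordᵈ⟧ (s , a) b with a ≟B b
  ... | yes _ = ⟦signᵈ⟧ s
  ... | no _  = ⟦0ᵈ⟧

  ⟦ΣLᵈ⟧ : ∀ {A : Set} (xs : List A) f → ⟦ ΣLᵈ xs f ⟧ ≈ ΣL xs (λ a → ⟦ f a ⟧)
  ⟦ΣLᵈ⟧ []       f = ⟦0ᵈ⟧
  ⟦ΣLᵈ⟧ (x ∷ xs) f = ≈-trans (⟦+ᵈ⟧ (f x) (ΣLᵈ xs f)) (+-congˡ (⟦ΣLᵈ⟧ xs f))

  ⟦canonical⟧ : ∀ z → ⟦ canonical z ⟧ ≈ ⟦ z ⟧
  ⟦canonical⟧ (zero  , zero)  = ≈-refl
  ⟦canonical⟧ (zero  , suc n) = ≈-refl
  ⟦canonical⟧ (suc p , zero)  = ≈-refl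
  ⟦canonical⟧ (suc p , suc n) = begin
    ⟦ canonical (p , n) ⟧        ≈⟨ ⟦canonical⟧ (p , n) ⟩
    ⟦ (p , n) ⟧                  ≈⟨ +-identityˡ ⟦ (p , n) ⟧ ⟨
    0# + ⟦ (p , n) ⟧             ≈⟨ +-congʳ (-‿inverseʳ ⟦ 1 ⟧ℕ) ⟨
    ⟦ (1 , 1) ⟧ + ⟦ (p , n) ⟧    ≈⟨ ⟦+ᵈ⟧ (1 , 1) (p , n) ⟨
    ⟦ (suc p , suc n) ⟧          ∎
    where open ≈-Reasoning

  ⟦⊟ᵈ⟧ : ∀ m n → ⟦ m ⊟ᵈ n ⟧ᴹ ≋ ⟦ m ⟧ᴹ ⊟ ⟦ n ⟧ᴹ
  ⟦⊟ᵈ⟧ m n a b = ≈-trans (⟦+ᵈ⟧ (m a b) (-ᵈ n a b)) (+-congˡ (⟦-ᵈ⟧ (n a b)))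

  ⟦monomialᵈ⟧ : ∀ φ → ⟦ monomialᵈ φ ⟧ᴹ ≋ monomial φ
  ⟦monomialᵈ⟧ φ a b = ⟦coordᵈ⟧ (φ b) a

  opaque
    unfolding _⋆_ tr

    ⟦⋆ᵈ⟧ : ∀ m n → ⟦ m ⋆ᵈ n ⟧ᴹ ≋ ⟦ m ⟧ᴹ ⋆ ⟦ n ⟧ᴹ
    ⟦⋆ᵈ⟧ m n a b = ≈-trans (⟦ΣLᵈ⟧ allBasis λ k → m a k *ᵈ n k b)
      (Σ-cong {λ k → ⟦ m a k *ᵈ n k b ⟧} {λ k → ⟦ m a k ⟧ * ⟦ n k b ⟧} λ k → ⟦*ᵈ⟧ (m a k) (n k b))

    ⟦trᵈ⟧ : ∀ m → ⟦ trᵈ m ⟧ ≈ tr ⟦ m ⟧ᴹ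
    ⟦trᵈ⟧ m = ⟦ΣLᵈ⟧ allBasis λ a → m a a

module Conjugation {c ℓ} (𝔽 : Field c ℓ) (char≠2 : CharNot2 𝔽) where
  open Field 𝔽 hiding (zero)
    renaming (refl to ≈-refl; sym to ≈-sym; trans to ≈-trans; reflexive to ≈-reflexive)
  open Oct 𝔽
  open LinearAlgebra 𝔽
  open import Algebra.Properties.Ring ring using (-1*x≈-x; x[y-z]≈xy-xz)
  open import Algebra.Properties.Group +-group using (⁻¹-involutive; ε⁻¹≈ε)
  open import Algebra.Properties.Semiring.Mult semiring using (×1-homo-*)

  *-nonzero : ∀ {x y} → x ≉ 0# → y ≉ 0# → x * y ≉ 0#
  *-nonzero {x} {y} x≉0 y≉0 xy≈0 = y≉0 (begin
    y                    ≈⟨ *-identityˡ y ⟨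
    1# * y               ≈⟨ *-congʳ (⁻¹-inverseʳ x x≉0) ⟨
    (x * x⁻¹) * y        ≈⟨ *-congʳ (*-comm x x⁻¹) ⟩
    (x⁻¹ * x) * y        ≈⟨ *-assoc x⁻¹ x y ⟩
    x⁻¹ * (x * y)        ≈⟨ *-congˡ xy≈0 ⟩
    x⁻¹ * 0#             ≈⟨ zeroʳ x⁻¹ ⟩
    0#                   ∎)
    where
    open ≈-Reasoning
    x⁻¹ : Carrier
    x⁻¹ = (x ⁻¹) x≉0

  2^k≉0 : ∀ k → ⟦ 2 ^ k ⟧ℕ ≉ 0#
  2^k≉0 zero    1≈0 = 0≉1 (≈-sym (≈-trans (≈-sym (+-identityʳ 1#)) 1≈0))
  2^k≉0 (suc k) 2^[1+k]≈0 =
    *-nonzero 2≉0 (2^k≉0 k) (≈-trans (≈-sym (×1-homo-* 2 (2 ^ k))) 2^[1+k]≈0)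
    where
    2≉0 : ⟦ 2 ⟧ℕ ≉ 0#
    2≉0 2≈0 = char≠2 (≈-trans (+-congˡ (≈-sym (+-identityʳ 1#))) 2≈0)

  +2^k≉0 : ∀ k → ⟦ (2 ^ k , 0) ⟧ ≉ 0#
  +2^k≉0 k ≈0 = 2^k≉0 k (≈-trans (≈-sym (x-0#≈x ⟦ 2 ^ k ⟧ℕ)) ≈0)

  -2^k≉0 : ∀ k → ⟦ (0 , 2 ^ k) ⟧ ≉ 0#
  -2^k≉0 k ≈0 = 2^k≉0 k (begin
    ⟦ 2 ^ k ⟧ℕ         ≈⟨ ⁻¹-involutive ⟦ 2 ^ k ⟧ℕ ⟨
    - - ⟦ 2 ^ k ⟧ℕ     ≈⟨ -‿cong (≈-trans (≈-sym (+-identityˡ (- ⟦ 2 ^ k ⟧ℕ))) ≈0) ⟩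
    - 0#               ≈⟨ ε⁻¹≈ε ⟩
    0#                 ∎)
    where open ≈-Reasoning

  canonical-sum≉0 : ∀ {x y} → x ∈ incidentTraces → y ∈ traceValues →
                    ⟦ canonical (x +ᵈ y) ⟧ ≉ 0#
  canonical-sum≉0 (here refl)         (here refl)                 = -2^k≉0 6
  canonical-sum≉0 (here refl)         (there (here refl))         = -2^k≉0 7
  canonical-sum≉0 (here refl)         (there (there (here refl))) = -2^k≉0 5
  canonical-sum≉0 (there (here refl)) (here refl)                 = +2^k≉0 5
  canonical-sum≉0 (there (here refl)) (there (here refl))         = -2^k≉0 5
  canonical-sum≉0 (there (here refl)) (there (there (here refl))) = +2^k≉0 6

  incident-trace-sum≉0 : ∀ x y → canonical x ∈ incidentTraces → canonical y ∈ traceValues →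
                         ⟦ x ⟧ + ⟦ y ⟧ ≉ 0#
  incident-trace-sum≉0 x y x∈ y∈ x+y≈0 = canonical-sum≉0 x∈ y∈ (begin
    ⟦ canonical (canonical x +ᵈ canonical y) ⟧   ≈⟨ ⟦canonical⟧ (canonical x +ᵈ canonical y) ⟩
    ⟦ canonical x +ᵈ canonical y ⟧               ≈⟨ ⟦+ᵈ⟧ (canonical x) (canonical y) ⟩
    ⟦ canonical x ⟧ + ⟦ canonical y ⟧            ≈⟨ +-cong (⟦canonical⟧ x) (⟦canonical⟧ y) ⟩
    ⟦ x ⟧ + ⟦ y ⟧                                ≈⟨ x+y≈0 ⟩
    0#                                           ∎)
    where open ≈-Reasoning

  q : Carrier
  q = quarter char≠2

  q≉0 : q ≉ 0#
  q≉0 = *-nonzero half≉0 half≉0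
    where
    half≉0 : half char≠2 ≉ 0#
    half≉0 ≈0 = 0≉1 (≈-trans (≈-sym (zeroʳ (1# + 1#)))
                      (≈-trans (*-congˡ (≈-sym ≈0)) (⁻¹-inverseʳ (1# + 1#) char≠2)))

  Xᴹ : Point → Line → Mat
  Xᴹ P D = q ∙ᴹ ⟦ Xᵈ P D ⟧ᴹ

  ⟦commᵈ⟧ : ∀ P Q → ⟦ commᵈ P Q ⟧ᴹ ≋
            monomial (left P) ⋆ monomial (left Q) ⊟ monomial (left Q) ⋆ monomial (left P)
  ⟦commᵈ⟧ P Q a b = ≈-trans (⟦⊟ᵈ⟧ (monomialᵈ (left P ∘ˢ left Q)) (monomialᵈ (left Q ∘ˢ left P)) a b)
    (+-cong (product P Q) (-‿cong (product Q P)))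
    where
    product : ∀ P Q →
              ⟦ monomialᵈ (left P ∘ˢ left Q) ⟧ᴹ a b ≈ (monomial (left P) ⋆ monomial (left Q)) a b
    product P Q =
      ≈-trans (⟦monomialᵈ⟧ (left P ∘ˢ left Q) a b) (≈-sym (monomial-⋆ (left P) (left Q) a b))

  Represents-eE : ∀ P Q → Represents (eE char≠2 P Q) (q ∙ᴹ ⟦ commᵈ P Q ⟧ᴹ)
  Represents-eE P Q =
    Represents-cong
      (Represents-*E q (Represents--E (Represents-∘E (Represents-L P) (Represents-L Q))
                                      (Represents-∘E (Represents-L Q) (Represents-L P))))
                    (λ a b → *-congˡ (≈-sym (⟦commᵈ⟧ P Q a b)))

  Represents-eE-eE : ∀ P Q P′ Q′ →
    Represents (eE char≠2 P Q -E eE char≠2 P′ Q′) (q ∙ᴹ ⟦ commᵈ P Q ⊟ᵈ commᵈ P′ Q′ ⟧ᴹ)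
  Represents-eE-eE P Q P′ Q′ =
    Represents-cong (Represents--E (Represents-eE P Q) (Represents-eE P′ Q′))
      λ a b → ≈-sym (≈-trans (*-congˡ (⟦⊟ᵈ⟧ (commᵈ P Q) (commᵈ P′ Q′) a b))
                             (x[y-z]≈xy-xz q (⟦ commᵈ P Q ⟧ᴹ a b) (⟦ commᵈ P′ Q′ ⟧ᴹ a b)))

  Represents-X : ∀ P D → Represents (X char≠2 P D) (Xᴹ P D)
  Represents-X i j with j ≟F i | j ≟F (i ⊹ 6) | j ≟F (i ⊹ 4)
  ... | yes _ | _     | _     = Represents-eE-eE (i ⊹ 2) (i ⊹ 6) (i ⊹ 4) (i ⊹ 5)
  ... | no _  | yes _ | _     = Represents-eE-eE (i ⊹ 4) (i ⊹ 5) (i ⊹ 1) (i ⊹ 3)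
  ... | no _  | no _  | yes _ = Represents-eE-eE (i ⊹ 1) (i ⊹ 3) (i ⊹ 2) (i ⊹ 6)
  ... | no _  | no _  | no _  = Represents-zeroE λ a b → ≈-trans (*-congˡ ⟦0ᵈ⟧) (zeroʳ q)

  tr-Xᴹ : ∀ P D P′ D′ → tr (Xᴹ P D ⋆ Xᴹ P′ D′) ≈ (q * q) * ⟦ trᵈ (Xᵈ P D ⋆ᵈ Xᵈ P′ D′) ⟧
  tr-Xᴹ P D P′ D′ = ≈-trans (tr-∙ᴹ q q ⟦ Xᵈ P D ⟧ᴹ ⟦ Xᵈ P′ D′ ⟧ᴹ)
    (*-congˡ (≈-sym (≈-trans (⟦trᵈ⟧ (Xᵈ P D ⋆ᵈ Xᵈ P′ D′)) (tr-cong (⟦⋆ᵈ⟧ (Xᵈ P D) (Xᵈ P′ D′))))))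

  tr-Xᴹ-sum≉0 : ∀ {P D D′} Q E E′ → P ∈L D → P ∈L D′ →
                tr (Xᴹ P D ⋆ Xᴹ P D′) + tr (Xᴹ Q E ⋆ Xᴹ Q E′) ≉ 0#
  tr-Xᴹ-sum≉0 {P} {D} {D′} Q E E′ P∈D P∈D′ sum≈0 =
    *-nonzero (*-nonzero q≉0 q≉0)
      (incident-trace-sum≉0 t t′ (trᵈ-Xᵈ-incident P D D′ P∈D P∈D′) (trᵈ-Xᵈ Q E E′))
      (begin
        (q * q) * (⟦ t ⟧ + ⟦ t′ ⟧)
          ≈⟨ distribˡ (q * q) ⟦ t ⟧ ⟦ t′ ⟧ ⟩
        (q * q) * ⟦ t ⟧ + (q * q) * ⟦ t′ ⟧
          ≈⟨ +-cong (tr-Xᴹ P D P D′) (tr-Xᴹ Q E Q E′) ⟨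
        tr (Xᴹ P D ⋆ Xᴹ P D′) + tr (Xᴹ Q E ⋆ Xᴹ Q E′)
          ≈⟨ sum≈0 ⟩
        0# ∎)
    where
    open ≈-Reasoning
    t t′ : Diff
    t  = trᵈ (Xᵈ P D ⋆ᵈ Xᵈ P D′)
    t′ = trᵈ (Xᵈ Q E ⋆ᵈ Xᵈ Q E′)

  x≈-y⇒x+y≈0 : ∀ {x y} → x ≈ - y → x + y ≈ 0#
  x≈-y⇒x+y≈0 {x} {y} x≈-y = ≈-trans (+-congʳ x≈-y) (-‿inverseˡ y)

  sign-≡ : ∀ s s′ {x y} → x ≈ ((s ⊙ 1#) * (s′ ⊙ 1#)) * y → x + y ≉ 0# → s ≡ s′
  sign-≡ ⊕ ⊕ _ _ = refl
  sign-≡ ⊖ ⊖ _ _ = refl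
  sign-≡ ⊕ ⊖ {y = y} x≈−y x+y≉0 = ⊥-elim (x+y≉0 (x≈-y⇒x+y≈0
    (≈-trans x≈−y (≈-trans (*-congʳ (*-identityˡ (- 1#))) (-1*x≈-x y)))))
  sign-≡ ⊖ ⊕ {y = y} x≈−y x+y≉0 = ⊥-elim (x+y≉0 (x≈-y⇒x+y≈0
    (≈-trans x≈−y (≈-trans (*-congʳ (*-identityʳ (- 1#))) (-1*x≈-x y)))))

  module _ (ĝ : SPt ↔ SPt) (aut : IsAut ĝ) where
    open Inverse ĝ using (to; from; strictlyInverseʳ)

    from-⊕ : ∀ {P s Q} → to (⊕ , P) ≡ (s , Q) → from (⊕ , Q) ≡ (s , P)
    from-⊕ {P} {⊕} to⊕P≡⊕Q = ≡.trans (≡.cong from (≡.sym to⊕P≡⊕Q)) (strictlyInverseʳ (⊕ , P))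
    from-⊕ {P} {⊖} to⊕P≡⊖Q =
      ≡.trans (≡.cong from (≡.sym (≡.trans (IsAut.odd aut (⊕ , P)) (≡.cong neg to⊕P≡⊖Q))))
              (strictlyInverseʳ (⊖ , P))

    onBasis-from∘to : ∀ a → (onBasis from ∘ˢ onBasis to) a ≡ (⊕ , a)
    onBasis-from∘to one = refl
    onBasis-from∘to (e P) with to (⊕ , P) in eq
    ... | s , Q rewrite from-⊕ eq = ≡.cong (_, e P) (s*s≡+ s)

    from⋆to≋1ᴹ : monomial (onBasis from) ⋆ monomial (onBasis to) ≋ 1ᴹ
    from⋆to≋1ᴹ a b = ≈-trans (monomial-⋆ (onBasis from) (onBasis to) a b)
                             (≈-reflexive (≡.cong (λ x → coord x a) (onBasis-from∘to b)))

    conjugate-Xᴹ : ∀ P D s → IsDelta char≠2 ĝ P D s →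
      monomial (onBasis to) ⋆ (Xᴹ P D ⋆ monomial (onBasis from)) ≋ (s ⊙ 1#) ∙ᴹ Xᴹ (π ĝ P) (πL ĝ D)
    conjugate-Xᴹ P D s =
      ≈E⇒≋ (Represents-∘E (Represents-ext to)
                          (Represents-∘E (Represents-X P D) (Represents-ext from)))
           (Represents-⊙E s (Represents-X (π ĝ P) (πL ĝ D)))

    tr-Xᴹ-conj : ∀ P D D′ s s′ → IsDelta char≠2 ĝ P D s → IsDelta char≠2 ĝ P D′ s′ →
      tr (Xᴹ P D ⋆ Xᴹ P D′) ≈
      ((s ⊙ 1#) * (s′ ⊙ 1#)) * tr (Xᴹ (π ĝ P) (πL ĝ D) ⋆ Xᴹ (π ĝ P) (πL ĝ D′))
    tr-Xᴹ-conj P D D′ s s′ δ δ′ = begin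
      tr (Xᴹ P D ⋆ Xᴹ P D′)                      ≈⟨ tr-conj (Xᴹ P D) (Xᴹ P D′) from⋆to≋1ᴹ ⟨
      tr ((G ⋆ (Xᴹ P D ⋆ H)) ⋆ (G ⋆ (Xᴹ P D′ ⋆ H)))
        ≈⟨ tr-cong (⋆-cong (conjugate-Xᴹ P D s δ) (conjugate-Xᴹ P D′ s′ δ′)) ⟩
      tr (((s ⊙ 1#) ∙ᴹ Y) ⋆ ((s′ ⊙ 1#) ∙ᴹ Y′))   ≈⟨ tr-∙ᴹ (s ⊙ 1#) (s′ ⊙ 1#) Y Y′ ⟩
      ((s ⊙ 1#) * (s′ ⊙ 1#)) * tr (Y ⋆ Y′)       ∎
      where
      open ≈-Reasoning
      G H Y Y′ : Mat
      G  = monomial (onBasis to)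
      H  = monomial (onBasis from)
      Y  = Xᴹ (π ĝ P) (πL ĝ D)
      Y′ = Xᴹ (π ĝ P) (πL ĝ D′)

proposition3p10 : ∀ {c ℓ} (𝔽 : Field c ℓ) (char≠2 : CharNot2 𝔽)
    (ĝ : SPt ↔ SPt) → IsAut ĝ →
    (P : Point) (D D′ : Line) → P ∈L D → P ∈L D′ →
    (s s′ : Sign) →
    Oct.IsDelta 𝔽 char≠2 ĝ P D s → Oct.IsDelta 𝔽 char≠2 ĝ P D′ s′ →
    s ≡ s′
proposition3p10 𝔽 char≠2 ĝ aut P D D′ P∈D P∈D′ s s′ δ δ′ =
  sign-≡ s s′ (tr-Xᴹ-conj ĝ aut P D D′ s s′ δ δ′)
              (tr-Xᴹ-sum≉0 (π ĝ P) (πL ĝ D) (πL ĝ D′) P∈D P∈D′)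
  where open Conjugation 𝔽 char≠2
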